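{- Let $f:\mathbb{N}\to\mathbb{C}$ be an arithmetic function and let $n,d\in\mathbb{N}$ with $d\mid n$. Then \[ \sum_{\substack{a=1\\ d\mid a}}^{n} f\big((a-1,n)\big)=\frac{n}{d}\sum_{\substack{e\mid n\\ (e,d)=1}}\frac{(\mu*f)(e)}{e}. \]
   Context: $(x,y)$ denotes the greatest common divisor of $x$ and $y$. $\mu$ is the Möbius function and $(\mu*f)(m)=\sum_{k\mid m}\mu(k)f(m/k)$ is the Dirichlet convolution. -}

module Defs where

open import Level using (Level)
open import Data.Nat using (ℕ; zero; suc; _*_; _/_; NonZero)
open import Data.Nat.Divisibility using (_∣_; _∣?_)
open import Data.Nat.Primality using (prime?)
open import Data.Integer using (ℤ; +_; -[1+_])
open import Data.Bool using (Bool; true; false; _∧_)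
open import Relation.Nullary using (Dec; yes; no)
open import Relation.Nullary.Decidable using (⌊_⌋)
open import Algebra.Bundles using (CommutativeRing)
import Algebra.Definitions.RawMonoid as RM

count< : ℕ → (ℕ → Bool) → ℕ
count< zero    P = 0
count< (suc m) P with P m
... | true  = suc (count< m P)
... | false = count< m P

-- Möbius function: μ(k) = 0 if p² ∣ k for some prime p,
-- otherwise (-1)^(number of distinct primes dividing k).  (μ(1) = 1.)
-- Primes dividing k are all ≤ k, so it suffices to look at p < suc k.
μ : ℕ → ℤ
μ k with count< (suc k) (λ p → ⌊ prime? p ⌋ ∧ ⌊ (p * p) ∣? k ⌋)
... | suc _ = + 0
... | zero  = sign (count< (suc k) (λ p → ⌊ prime? p ⌋ ∧ ⌊ p ∣? k ⌋))
  where
  sign : ℕ → ℤ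
  sign zero          = + 1
  sign (suc zero)    = -[1+ 0 ]
  sign (suc (suc r)) = sign r

module Arith {c ℓ : Level} (R : CommutativeRing c ℓ) where
  open CommutativeRing R
  open RM (+-rawMonoid) using (_×_)

  Σ< : ℕ → (ℕ → Carrier) → Carrier
  Σ< zero    g = 0#
  Σ< (suc m) g = Σ< m g + g m

  [_]· : {p : _} {P : Set p} → Dec P → Carrier → Carrier
  [ yes _ ]· x = x
  [ no  _ ]· x = 0#

  _⊙_ : ℤ → Carrier → Carrier
  (+ n)    ⊙ x = n × x
  -[1+ n ] ⊙ x = - (suc n × x)

  -- Dirichlet convolution (μ * f)(m) = Σ_{k ∣ m} μ(k) f(m/k), k ranging over 1..m
  μ*_ : (ℕ → Carrier) → ℕ → Carrier
  (μ* f) m = Σ< m (λ j → [ suc j ∣? m ]· (μ (suc j) ⊙ f (m / suc j)))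

{-# OPTIONS --safe #-}

-- Möbius inversion f(m) = Σ_{e ∣ m} (μ * f)(e), applied to f((a - 1, n)), turns the left-hand side
-- into Σ_{e ∣ n} (μ * f)(e) · #{a ≤ n : d ∣ a, e ∣ a - 1}.  A divisor of a and a divisor of a - 1
-- are coprime, so the count vanishes unless (e, d) = 1; then, writing a = d t, the congruence
-- d t ≡ 1 (mod e) has exactly one solution in every block of e consecutive t, and e ∣ n / d, so the
-- count is n / (d e).  Möbius inversion itself rests on Σ_{k ∣ N} μ(k) = [N = 1]: for a prime p ∣ N
-- the terms with p ∣ k cancel those with p ∤ k, because μ(p k) = -μ(k) when p ∤ k and μ(p k) = 0
-- otherwise, which is read off from the prime counts defining μ.

module Submission where

open import Defs
open import Level using (Level)
open import Algebra.Bundles using (CommutativeRing)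
import Algebra.Definitions.RawMonoid as RM
import Algebra.Properties.AbelianGroup as AbelianGroupProperties
import Algebra.Properties.CommutativeSemigroup as CommutativeSemigroupProperties
open import Data.Bool using (Bool; true; false; _∧_)
open import Data.Empty using (⊥-elim)
open import Data.Integer as ℤ using (ℤ; -[1+_]; 0ℤ; 1ℤ; -1ℤ; _^_)
open import Data.Integer.Properties using (neg-involutive; -1*i≡-i)
open import Data.List using ([]; _∷_)
open import Data.List.Relation.Unary.All using (_∷_)
open import Data.Nat
  using (ℕ; zero; suc; pred; _+_; _*_; _∸_; _/_; _%_; _≤_; _<_; s≤s; z≤n;
         NonZero; ≢-nonZero; ≢-nonZero⁻¹; >-nonZero; nonTrivial⇒≢1)
open import Data.Nat.Coprimality using (Coprime; coprime-divisor; coprime-Bézout; gcd≡1⇒coprime)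
open import Data.Nat.Divisibility
  using (_∣_; _∣?_; ∣⇒≤; ∣-refl; ∣-trans; ∣1⇒≡1; ∣m+n∣m⇒∣n; ∣m∣n⇒∣m+n; n∣m*n; m∣m*n;
         ∣n⇒∣m*n; m*n∣⇒n∣; *-monoʳ-∣; *-cancelˡ-∣; m*n∣o⇒m∣o/n; m∣n/o⇒m*o∣n)
open import Data.Nat.DivMod
  using (m*[n/m]≡n; m≡m%n+[m/n]*n; m%n<n; m*n/n≡m; m/n≤m; m/n*n≡m; n/n≡1; m≥n⇒m/n>0)
open import Data.Nat.GCD using (gcd; gcd[m,n]∣m; gcd[m,n]∣n; gcd-greatest; gcd[m,n]≢0; module Bézout)
open import Data.Nat.ListAction using (product)
open import Data.Nat.Primality
  using (Prime; prime?; prime⇒nonZero; prime⇒nonTrivial; prime⇒irreducible; euclidsLemma)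
open import Data.Nat.Primality.Factorisation using (factorise)
import Data.Nat.Properties as ℕ
open import Data.Nat.Properties using () renaming (_≟_ to _≟ℕ_)
open import Data.Nat.Properties
  using (_≟_; +-comm; *-comm; *-identityˡ; *-zeroʳ; +-cancelʳ-≡; 0≢1+n; suc-pred; m*n≢0⇒n≢0;
         n<1+n; m<n⇒m<1+n; ≤-pred; ≤-reflexive; ≤-trans; ≤-<-trans; ≤-total; <⇒≢; <⇒≱; ≤∧≢⇒<;
         m≤n⇒m<n∨m≡n; m≤m*n; m≤n*m; m+[n∸m]≡n; m∸n≤m; ≤-antisym; +-suc)
open import Data.Nat.Tactic.RingSolver using (solve-∀)
open import Data.Product using (_×_; _,_; ∃)
open import Data.Sum using (inj₁; inj₂; reduce)
open import Function.Base using (_∘_)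
open import Function.Bundles using (_⇔_; mk⇔; Equivalence)
open import Relation.Binary.PropositionalEquality
  using (_≡_; _≢_; refl; sym; trans; cong; subst; module ≡-Reasoning)
import Relation.Binary.Reasoning.Setoid as SetoidReasoning
open import Relation.Nullary using (¬_; ¬?; yes; no; _×-dec_)
open import Relation.Nullary.Decidable using (Dec; does; ⌊_⌋; isYes≗does; dec-true; dec-false; does-⇔)

-- Counting

module _ {a b} {A : Set a} {B : Set b} where

  isYes∧isYes≡does-×-dec : (a? : Dec A) (b? : Dec B) → ⌊ a? ⌋ ∧ ⌊ b? ⌋ ≡ does (a? ×-dec b?)
  isYes∧isYes≡does-×-dec (yes _) b? = isYes≗does b?
  isYes∧isYes≡does-×-dec (no _)  b? = refl

  isYes∧isYes-true : (a? : Dec A) (b? : Dec B) → A × B → ⌊ a? ⌋ ∧ ⌊ b? ⌋ ≡ true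
  isYes∧isYes-true a? b? ab = trans (isYes∧isYes≡does-×-dec a? b?) (dec-true (a? ×-dec b?) ab)

  isYes∧isYes-false : (a? : Dec A) (b? : Dec B) → ¬ (A × B) → ⌊ a? ⌋ ∧ ⌊ b? ⌋ ≡ false
  isYes∧isYes-false a? b? ¬ab = trans (isYes∧isYes≡does-×-dec a? b?) (dec-false (a? ×-dec b?) ¬ab)

isYes∧isYes-⇔ : ∀ {a b c d} {A : Set a} {B : Set b} {C : Set c} {D : Set d} →
                (a? : Dec A) (b? : Dec B) (c? : Dec C) (d? : Dec D) →
                (A × B → C × D) → (C × D → A × B) → ⌊ a? ⌋ ∧ ⌊ b? ⌋ ≡ ⌊ c? ⌋ ∧ ⌊ d? ⌋
isYes∧isYes-⇔ a? b? c? d? to from = begin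
  ⌊ a? ⌋ ∧ ⌊ b? ⌋      ≡⟨ isYes∧isYes≡does-×-dec a? b? ⟩
  does (a? ×-dec b?)  ≡⟨ does-⇔ (mk⇔ to from) (a? ×-dec b?) (c? ×-dec d?) ⟩
  does (c? ×-dec d?)  ≡⟨ isYes∧isYes≡does-×-dec c? d? ⟨
  ⌊ c? ⌋ ∧ ⌊ d? ⌋      ∎
  where open ≡-Reasoning

module _ {P Q : ℕ → Bool} where

  count<-cong : ∀ m → (∀ {j} → j < m → P j ≡ Q j) → count< m P ≡ count< m Q
  count<-cong zero    _   = refl
  count<-cong (suc m) P≗Q with P m | Q m | P≗Q (n<1+n m)
  ... | true  | .true  | refl = cong suc (count<-cong m (λ j<m → P≗Q (m<n⇒m<1+n j<m)))
  ... | false | .false | refl = count<-cong m (λ j<m → P≗Q (m<n⇒m<1+n j<m))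

  count<-insert : ∀ m {w} → w < m → P w ≡ true → Q w ≡ false →
                  (∀ {j} → j ≢ w → P j ≡ Q j) → count< m P ≡ suc (count< m Q)
  count<-insert (suc m) {w} w<1+m Pw Qw P≗Q with m ≟ w
  ... | yes refl rewrite Pw | Qw = cong suc (count<-cong m (λ j<m → P≗Q (<⇒≢ j<m)))
  ... | no m≢w with P m | Q m | P≗Q m≢w
                  | count<-insert m (≤∧≢⇒< (≤-pred w<1+m) (m≢w ∘ sym)) Pw Qw P≗Q
  ...   | true  | .true  | refl | ih = cong suc ih
  ...   | false | .false | refl | ih = ih

module _ {P : ℕ → Bool} where

  count<-false-above : ∀ {a b} → a ≤ b → (∀ {j} → a ≤ j → P j ≡ false) → count< b P ≡ count< a P
  count<-false-above {b = zero}  z≤n _ = refl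
  count<-false-above {a} {suc b} a≤1+b Pj with m≤n⇒m<n∨m≡n a≤1+b
  ... | inj₂ refl = refl
  ... | inj₁ a<1+b with P b | Pj (≤-pred a<1+b)
  ...   | .false | refl = count<-false-above (≤-pred a<1+b) Pj

  count<-nonZero : ∀ m {w} → w < m → P w ≡ true → NonZero (count< m P)
  count<-nonZero (suc m) {w} w<1+m Pw with m ≟ w
  ... | yes refl rewrite Pw = _
  ... | no m≢w with P m
  ...   | true  = _
  ...   | false = count<-nonZero m (≤∧≢⇒< (≤-pred w<1+m) (m≢w ∘ sym)) Pw

-- Divisibility

prime∣prime⇒≡ : ∀ {p q} → Prime p → Prime q → p ∣ q → p ≡ q
prime∣prime⇒≡ p-prime q-prime p∣q with prime⇒irreducible q-prime p∣q
... | inj₁ p≡1 = ⊥-elim (nonTrivial⇒≢1 {{prime⇒nonTrivial p-prime}} p≡1)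
... | inj₂ p≡q = p≡q

prime∤⇒coprime : ∀ {p a} → Prime p → ¬ p ∣ a → Coprime a p
prime∤⇒coprime p-prime p∤a (i∣a , i∣p) with prime⇒irreducible p-prime i∣p
... | inj₁ i≡1 = i≡1
... | inj₂ refl = ⊥-elim (p∤a i∣a)

prime-factor : ∀ N .{{_ : NonZero N}} → N ≢ 1 → ∃ λ p → ∃ λ M → Prime p × p * M ≡ N
prime-factor N N≢1 with factorise N
... | record { factors = [] ; isFactorisation = N≡1 } = ⊥-elim (N≢1 N≡1)
... | record { factors = p ∷ ps ; isFactorisation = N≡p*∏ps ; factorsPrime = p-prime ∷ _ } =
  p , product ps , p-prime , sym N≡p*∏ps

multiple-in-block : ∀ q {b u} → u < b → b ∣ suc (q * b + u) → suc u ≡ b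
multiple-in-block q {b} {u} u<b b∣ = ≤-antisym u<b (∣⇒≤ b∣1+u)
  where
  b∣1+u : b ∣ suc u
  b∣1+u = ∣m+n∣m⇒∣n (subst (b ∣_) (sym (+-suc (q * b) u)) b∣) (n∣m*n q)

1+[q*b+pred[b]]≡b*[1+q] : ∀ q b .{{_ : NonZero b}} → suc (q * b + pred b) ≡ b * suc q
1+[q*b+pred[b]]≡b*[1+q] q b = begin
  suc (q * b + pred b)  ≡⟨ +-suc (q * b) (pred b) ⟨
  q * b + suc (pred b)  ≡⟨ cong (λ x → q * b + x) (suc-pred b) ⟩
  q * b + b             ≡⟨ +-comm (q * b) b ⟩
  suc q * b             ≡⟨ *-comm (suc q) b ⟩
  b * suc q             ∎
  where open ≡-Reasoning

∣j∧∣1+j⇒gcd≡1 : ∀ {e d j} → e ∣ j → d ∣ suc j → gcd e d ≡ 1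
∣j∧∣1+j⇒gcd≡1 {e} {d} {j} e∣j d∣1+j =
  ∣1⇒≡1 (∣m+n∣m⇒∣n g∣j+1 (∣-trans (gcd[m,n]∣m e d) e∣j))
  where
  g∣j+1 : gcd e d ∣ j + 1
  g∣j+1 = subst (gcd e d ∣_) (+-comm 1 j) (∣-trans (gcd[m,n]∣n e d) d∣1+j)

m*n/m≡n : ∀ m n .{{_ : NonZero m}} → m * n / m ≡ n
m*n/m≡n m n = trans (cong (_/ m) (*-comm m n)) (m*n/n≡m n m)

m/n≡1⇒n≡m : ∀ {m n} .{{_ : NonZero n}} → n ∣ m → m / n ≡ 1 → n ≡ m
m/n≡1⇒n≡m {m} {n} n∣m m/n≡1 = trans (sym (*-identityˡ n)) (trans (cong (_* n) (sym m/n≡1)) (m/n*n≡m n∣m))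

∣1+j∧∣gcd[j,n]⇒∣n×gcd≡1 : ∀ {d e j n} → d ∣ suc j → e ∣ gcd j n → e ∣ n × gcd e d ≡ 1
∣1+j∧∣gcd[j,n]⇒∣n×gcd≡1 {j = j} {n} d∣1+j e∣gcd =
  ∣-trans e∣gcd (gcd[m,n]∣n j n) , ∣j∧∣1+j⇒gcd≡1 (∣-trans e∣gcd (gcd[m,n]∣m j n)) d∣1+j

-- The Möbius function

isPrimeSquareDivisor isPrimeDivisor : ℕ → ℕ → Bool
isPrimeSquareDivisor k p = ⌊ prime? p ⌋ ∧ ⌊ (p * p) ∣? k ⌋
isPrimeDivisor       k p = ⌊ prime? p ⌋ ∧ ⌊ p ∣? k ⌋

primeSquareDivisorCount primeDivisorCount : ℕ → ℕ
primeSquareDivisorCount k = count< (suc k) (isPrimeSquareDivisor k)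
primeDivisorCount       k = count< (suc k) (isPrimeDivisor k)

μ≡0 : ∀ k → NonZero (primeSquareDivisorCount k) → μ k ≡ 0ℤ
μ≡0 k nz with primeSquareDivisorCount k
... | suc _ = refl
... | zero  = ⊥-elim (≢-nonZero⁻¹ 0 {{nz}} refl)

periodic-sign≡-1^ : {s : ℕ → ℤ} → s 0 ≡ 1ℤ → s 1 ≡ -1ℤ → (∀ c → s (suc (suc c)) ≡ s c) →
                    ∀ c → s c ≡ -1ℤ ^ c
periodic-sign≡-1^ s₀ s₁ period zero          = s₀
periodic-sign≡-1^ s₀ s₁ period (suc zero)    = s₁
periodic-sign≡-1^ {s} s₀ s₁ period (suc (suc c)) = begin
  s (suc (suc c))        ≡⟨ period c ⟩
  s c                    ≡⟨ periodic-sign≡-1^ s₀ s₁ period c ⟩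
  -1ℤ ^ c                ≡⟨ neg-involutive (-1ℤ ^ c) ⟨
  ℤ.- ℤ.- (-1ℤ ^ c)      ≡⟨ cong ℤ.-_ (-1*i≡-i (-1ℤ ^ c)) ⟨
  ℤ.- (-1ℤ ^ suc c)      ≡⟨ -1*i≡-i (-1ℤ ^ suc c) ⟨
  -1ℤ ^ suc (suc c)      ∎
  where open ≡-Reasoning

μ≡-1^primeDivisorCount : ∀ k → primeSquareDivisorCount k ≡ 0 → μ k ≡ -1ℤ ^ primeDivisorCount k
μ≡-1^primeDivisorCount k = go
  where
  -- Unification solves s as the sign function local to the definition of μ, which cannot be named.
  s : ℕ → ℤ
  s = _
  go : primeSquareDivisorCount k ≡ 0 → μ k ≡ -1ℤ ^ primeDivisorCount k
  go eq with primeSquareDivisorCount k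
  go refl | .0 with primeDivisorCount k
  ... | c = periodic-sign≡-1^ {s = s} refl refl (λ _ → refl) c

module _ {p k : ℕ} (p-prime : Prime p) .{{_ : NonZero k}} where

  private instance
    p≢0 : NonZero p
    p≢0 = prime⇒nonZero p-prime

  μ[p*k]≡0 : p ∣ k → μ (p * k) ≡ 0ℤ
  μ[p*k]≡0 p∣k = μ≡0 (p * k) (count<-nonZero {isPrimeSquareDivisor (p * k)} (suc (p * k)) (s≤s (m≤m*n p k))
    (isYes∧isYes-true (prime? p) ((p * p) ∣? (p * k)) (p-prime , *-monoʳ-∣ p p∣k)))

  module _ (p∤k : ¬ p ∣ k) where

    prime²∣p*k⇒prime²∣k : ∀ {q} → Prime q → q * q ∣ p * k → q * q ∣ k
    prime²∣p*k⇒prime²∣k {q} q-prime q²∣pk with q ≟ p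
    ... | yes refl = ⊥-elim (p∤k (*-cancelˡ-∣ p q²∣pk))
    ... | no q≢p = coprime-divisor (prime∤⇒coprime p-prime p∤q²) q²∣pk
      where
      p∤q² : ¬ p ∣ q * q
      p∤q² p∣q² = q≢p (sym (prime∣prime⇒≡ p-prime q-prime (reduce (euclidsLemma q q p-prime p∣q²))))

    primeSquareDivisorCount[p*k] : primeSquareDivisorCount (p * k) ≡ primeSquareDivisorCount k
    primeSquareDivisorCount[p*k] = begin
      count< (suc (p * k)) (isPrimeSquareDivisor (p * k))
        ≡⟨ count<-cong {isPrimeSquareDivisor (p * k)} (suc (p * k)) (λ {q} _ → sameSquares q) ⟩
      count< (suc (p * k)) (isPrimeSquareDivisor k)
        ≡⟨ count<-false-above {isPrimeSquareDivisor k} (s≤s (m≤n*m k p)) noSquaresAbove ⟩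
      count< (suc k) (isPrimeSquareDivisor k)
        ∎
      where
      open ≡-Reasoning
      sameSquares : ∀ q → isPrimeSquareDivisor (p * k) q ≡ isPrimeSquareDivisor k q
      sameSquares q = isYes∧isYes-⇔ (prime? q) _ (prime? q) _
        (λ (q-prime , q²∣pk) → q-prime , prime²∣p*k⇒prime²∣k q-prime q²∣pk)
        (λ (q-prime , q²∣k) → q-prime , ∣n⇒∣m*n p q²∣k)
      noSquaresAbove : ∀ {q} → suc k ≤ q → isPrimeSquareDivisor k q ≡ false
      noSquaresAbove {q} k<q = isYes∧isYes-false (prime? q) ((q * q) ∣? k) (λ (q-prime , q²∣k) →
        <⇒≱ k<q (≤-trans (m≤m*n q q {{prime⇒nonZero q-prime}}) (∣⇒≤ q²∣k)))

    primeDivisorCount[p*k] : primeDivisorCount (p * k) ≡ suc (primeDivisorCount k)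
    primeDivisorCount[p*k] = begin
      count< (suc (p * k)) (isPrimeDivisor (p * k))
        ≡⟨ count<-insert {isPrimeDivisor (p * k)} (suc (p * k)) (s≤s (m≤m*n p k))
             p-counted p-not-counted sameOtherPrimes ⟩
      suc (count< (suc (p * k)) (isPrimeDivisor k))
        ≡⟨ cong suc (count<-false-above {isPrimeDivisor k} (s≤s (m≤n*m k p)) noPrimesAbove) ⟩
      suc (count< (suc k) (isPrimeDivisor k))
        ∎
      where
      open ≡-Reasoning
      p-counted : isPrimeDivisor (p * k) p ≡ true
      p-counted = isYes∧isYes-true (prime? p) (p ∣? (p * k)) (p-prime , m∣m*n k)
      p-not-counted : isPrimeDivisor k p ≡ false
      p-not-counted = isYes∧isYes-false (prime? p) (p ∣? k) (λ (_ , p∣k) → p∤k p∣k)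
      q∣k : ∀ {q} → Prime q → q ≢ p → q ∣ p * k → q ∣ k
      q∣k q-prime q≢p q∣pk with euclidsLemma p k q-prime q∣pk
      ... | inj₁ q∣p = ⊥-elim (q≢p (prime∣prime⇒≡ q-prime p-prime q∣p))
      ... | inj₂ q∣k = q∣k
      sameOtherPrimes : ∀ {q} → q ≢ p → isPrimeDivisor (p * k) q ≡ isPrimeDivisor k q
      sameOtherPrimes {q} q≢p = isYes∧isYes-⇔ (prime? q) _ (prime? q) _
        (λ (q-prime , q∣pk) → q-prime , q∣k q-prime q≢p q∣pk)
        (λ (q-prime , q∣k) → q-prime , ∣n⇒∣m*n p q∣k)
      noPrimesAbove : ∀ {q} → suc k ≤ q → isPrimeDivisor k q ≡ false
      noPrimesAbove {q} k<q = isYes∧isYes-false (prime? q) (q ∣? k) (λ (_ , q∣k) → <⇒≱ k<q (∣⇒≤ q∣k))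

    μ[p*k]≡-μ[k] : μ (p * k) ≡ ℤ.- μ k
    μ[p*k]≡-μ[k] with primeSquareDivisorCount k ≟ 0
    ... | no count≢0 = begin
      μ (p * k)    ≡⟨ μ≡0 (p * k) (subst NonZero (sym primeSquareDivisorCount[p*k]) (≢-nonZero count≢0)) ⟩
      0ℤ           ≡⟨ cong ℤ.-_ (μ≡0 k (≢-nonZero count≢0)) ⟨
      ℤ.- μ k      ∎
      where open ≡-Reasoning
    ... | yes eq = begin
      μ (p * k)                         ≡⟨ μ≡-1^primeDivisorCount (p * k) (trans primeSquareDivisorCount[p*k] eq) ⟩
      -1ℤ ^ primeDivisorCount (p * k)   ≡⟨ cong (-1ℤ ^_) primeDivisorCount[p*k] ⟩
      -1ℤ ℤ.* -1ℤ ^ primeDivisorCount k ≡⟨ -1*i≡-i _ ⟩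
      ℤ.- (-1ℤ ^ primeDivisorCount k)   ≡⟨ cong ℤ.-_ (μ≡-1^primeDivisorCount k eq) ⟨
      ℤ.- μ k                           ∎
      where open ≡-Reasoning

-- Inverses modulo E

-- E ∣ pred (d * suc t) says that d · (t + 1) ≡ 1 (mod E).

pred[d*suc[t+k]]≡pred[d*suc[t]]+d*k : ∀ d .{{_ : NonZero d}} t k →
                                      pred (d * suc (t + k)) ≡ pred (d * suc t) + d * k
pred[d*suc[t+k]]≡pred[d*suc[t]]+d*k (suc d-1) = identity d-1
  where
  identity : ∀ d-1 t k → (t + k) + d-1 * suc (t + k) ≡ (t + d-1 * suc t) + suc d-1 * k
  identity = solve-∀

∣pred[d*suc[t+k]]⇔ : ∀ {E d} .{{_ : NonZero d}} t {k} → E ∣ d * k →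
                     E ∣ pred (d * suc (t + k)) ⇔ E ∣ pred (d * suc t)
∣pred[d*suc[t+k]]⇔ {E} {d} t {k} E∣dk = mk⇔
  (λ E∣ → ∣m+n∣m⇒∣n (subst (E ∣_) (trans eq (+-comm _ (d * k))) E∣) E∣dk)
  (λ E∣ → subst (E ∣_) (sym eq) (∣m∣n⇒∣m+n E∣ E∣dk))
  where
  eq : pred (d * suc (t + k)) ≡ pred (d * suc t) + d * k
  eq = pred[d*suc[t+k]]≡pred[d*suc[t]]+d*k d t k

∣∧<⇒≡0 : ∀ {E k} → E ∣ k → k < E → k ≡ 0
∣∧<⇒≡0 {k = zero}  _   _   = refl
∣∧<⇒≡0 {k = suc _} E∣k k<E = ⊥-elim (<⇒≱ k<E (∣⇒≤ E∣k))

coprime⇒invertible : ∀ {E d} .{{_ : NonZero E}} .{{_ : NonZero d}} → Coprime E d →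
                     ∃ λ s → ∃ λ w → d * s ≡ suc (w * E)
coprime⇒invertible {suc E-1} {suc d-1} E⊥d with coprime-Bézout E⊥d
... | Bézout.-+ x y 1+xE≡yd = y , x , trans (*-comm (suc d-1) y) (sym 1+xE≡yd)
-- Here d · y ≡ -1 (mod E), so y · (E - 1) + E is an inverse of d.
... | Bézout.+- x y 1+yd≡xE = y * E-1 + suc E-1 , E-1 * x + d-1 , +-cancelʳ-≡ E-1 _ _ (begin
  suc d-1 * (y * E-1 + suc E-1) + E-1          ≡⟨ lhs d-1 E-1 y ⟩
  E-1 * suc (y * suc d-1) + suc d-1 * suc E-1  ≡⟨ cong (λ z → E-1 * z + suc d-1 * suc E-1) 1+yd≡xE ⟩
  E-1 * (x * suc E-1) + suc d-1 * suc E-1      ≡⟨ rhs d-1 E-1 x ⟩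
  suc ((E-1 * x + d-1) * suc E-1) + E-1        ∎)
  where
  open ≡-Reasoning
  lhs : ∀ d-1 E-1 y → suc d-1 * (y * E-1 + suc E-1) + E-1 ≡ E-1 * suc (y * suc d-1) + suc d-1 * suc E-1
  lhs = solve-∀
  rhs : ∀ d-1 E-1 x → E-1 * (x * suc E-1) + suc d-1 * suc E-1 ≡ suc ((E-1 * x + d-1) * suc E-1) + E-1
  rhs = solve-∀

module _ {E d : ℕ} .{{_ : NonZero E}} .{{_ : NonZero d}} (E⊥d : Coprime E d) where

  inverse-residue : ∃ λ t → t < E × E ∣ pred (d * suc t)
  inverse-residue with coprime⇒invertible E⊥d
  ... | zero  , w , d*0≡1+wE = ⊥-elim (0≢1+n (trans (sym (*-zeroʳ d)) d*0≡1+wE))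
  ... | suc s , w , d*s≡1+wE = s % E , m%n<n s E ,
    Equivalence.to (∣pred[d*suc[t+k]]⇔ (s % E) (∣n⇒∣m*n d (n∣m*n (s / E))))
      (subst (λ a → E ∣ pred (d * suc a)) (m≡m%n+[m/n]*n s E)
        (subst (E ∣_) (cong pred (sym d*s≡1+wE)) (n∣m*n w)))

  inverse-residue-unique≤ : ∀ {t u} → t ≤ u → u < E →
                            E ∣ pred (d * suc t) → E ∣ pred (d * suc u) → t ≡ u
  inverse-residue-unique≤ {t} {u} t≤u u<E E∣t E∣u = begin
    t            ≡⟨ ℕ.+-identityʳ t ⟨
    t + 0        ≡⟨ cong (t +_) u∸t≡0 ⟨
    t + (u ∸ t)  ≡⟨ m+[n∸m]≡n t≤u ⟩
    u            ∎
    where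
    open ≡-Reasoning
    E∣d*[u∸t] : E ∣ d * (u ∸ t)
    E∣d*[u∸t] = ∣m+n∣m⇒∣n (subst (E ∣_) (pred[d*suc[t+k]]≡pred[d*suc[t]]+d*k d t (u ∸ t))
                  (subst (λ a → E ∣ pred (d * suc a)) (sym (m+[n∸m]≡n t≤u)) E∣u)) E∣t
    u∸t≡0 : u ∸ t ≡ 0
    u∸t≡0 = ∣∧<⇒≡0 (coprime-divisor E⊥d E∣d*[u∸t]) (≤-<-trans (m∸n≤m u t) u<E)

  inverse-residue-unique : ∀ {t u} → t < E → u < E → E ∣ pred (d * suc t) → E ∣ pred (d * suc u) → t ≡ u
  inverse-residue-unique {t} {u} t<E u<E E∣t E∣u with ≤-total t u
  ... | inj₁ t≤u = inverse-residue-unique≤ t≤u u<E E∣t E∣u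
  ... | inj₂ u≤t = sym (inverse-residue-unique≤ u≤t t<E E∣u E∣t)

-- Finite sums in a commutative ring

module Sums {c ℓ : Level} (R : CommutativeRing c ℓ) where

  open CommutativeRing R
    using (Carrier; _≈_; 0#; -_; setoid; +-cong; +-congˡ; +-congʳ; +-assoc; +-identityˡ; +-identityʳ;
           +-abelianGroup; +-commutativeSemigroup; +-rawMonoid; -‿cong; -‿inverseˡ; reflexive)
    renaming (_+_ to _⊕_; refl to ≈-refl; sym to ≈-sym; trans to ≈-trans)
  open Arith R
  open RM (+-rawMonoid) using () renaming (_×_ to _·ℕ_)
  open AbelianGroupProperties +-abelianGroup using (ε⁻¹≈ε; ⁻¹-involutive; ⁻¹-∙-comm)
  open CommutativeSemigroupProperties +-commutativeSemigroup using (interchange)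
  open SetoidReasoning setoid

  Σ<-cong : ∀ n {g h : ℕ → Carrier} → (∀ j → g j ≈ h j) → Σ< n g ≈ Σ< n h
  Σ<-cong zero    _   = ≈-refl
  Σ<-cong (suc n) g≈h = +-cong (Σ<-cong n g≈h) (g≈h n)

  Σ<-zero : ∀ n {g : ℕ → Carrier} → (∀ {j} → j < n → g j ≈ 0#) → Σ< n g ≈ 0#
  Σ<-zero zero    _   = ≈-refl
  Σ<-zero (suc n) g≈0 =
    ≈-trans (+-cong (Σ<-zero n (λ j<n → g≈0 (m<n⇒m<1+n j<n))) (g≈0 (n<1+n n))) (+-identityʳ 0#)

  Σ<-distrib-⊕ : ∀ n (g h : ℕ → Carrier) → Σ< n (λ j → g j ⊕ h j) ≈ Σ< n g ⊕ Σ< n h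
  Σ<-distrib-⊕ zero    g h = ≈-sym (+-identityʳ 0#)
  Σ<-distrib-⊕ (suc n) g h = ≈-trans (+-congʳ (Σ<-distrib-⊕ n g h)) (interchange _ _ _ _)

  Σ<-distrib-neg : ∀ n (g : ℕ → Carrier) → Σ< n (λ j → - g j) ≈ - Σ< n g
  Σ<-distrib-neg zero    g = ≈-sym ε⁻¹≈ε
  Σ<-distrib-neg (suc n) g = ≈-trans (+-congʳ (Σ<-distrib-neg n g)) (⁻¹-∙-comm (Σ< n g) (g n))

  Σ<-split : ∀ a b (g : ℕ → Carrier) → Σ< (a + b) g ≈ Σ< a g ⊕ Σ< b (λ j → g (a + j))
  Σ<-split a zero    g = begin
    Σ< (a + 0) g  ≡⟨ cong (λ m → Σ< m g) (ℕ.+-identityʳ a) ⟩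
    Σ< a g        ≈⟨ +-identityʳ _ ⟨
    Σ< a g ⊕ 0#   ∎
  Σ<-split a (suc b) g = begin
    Σ< (a + suc b) g                               ≡⟨ cong (λ m → Σ< m g) (+-suc a b) ⟩
    Σ< (a + b) g ⊕ g (a + b)                       ≈⟨ +-congʳ (Σ<-split a b g) ⟩
    (Σ< a g ⊕ Σ< b (λ j → g (a + j))) ⊕ g (a + b)  ≈⟨ +-assoc _ _ _ ⟩
    Σ< a g ⊕ Σ< (suc b) (λ j → g (a + j))          ∎

  Σ<-truncate : ∀ {a b} (g : ℕ → Carrier) → a ≤ b → (∀ {j} → a ≤ j → g j ≈ 0#) → Σ< b g ≈ Σ< a g
  Σ<-truncate {b = zero}  g z≤n _ = ≈-refl
  Σ<-truncate {a} {suc b} g a≤1+b g≈0 with m≤n⇒m<n∨m≡n a≤1+b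
  ... | inj₂ refl = ≈-refl
  ... | inj₁ a<1+b = begin
    Σ< b g ⊕ g b   ≈⟨ +-cong (Σ<-truncate g (≤-pred a<1+b) g≈0) (g≈0 (≤-pred a<1+b)) ⟩
    Σ< a g ⊕ 0#    ≈⟨ +-identityʳ _ ⟩
    Σ< a g         ∎

  Σ<-comm : ∀ m n (h : ℕ → ℕ → Carrier) →
            Σ< m (λ i → Σ< n (h i)) ≈ Σ< n (λ j → Σ< m (λ i → h i j))
  Σ<-comm zero    n h = ≈-sym (Σ<-zero n (λ _ → ≈-refl))
  Σ<-comm (suc m) n h =
    ≈-trans (+-congʳ (Σ<-comm m n h)) (≈-sym (Σ<-distrib-⊕ n (λ j → Σ< m (λ i → h i j)) (h m)))

  Σ<-single : ∀ n (g : ℕ → Carrier) {t} → t < n → (∀ {j} → j < n → j ≢ t → g j ≈ 0#) →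
              Σ< n g ≈ g t
  Σ<-single (suc n) g {t} t<1+n g≈0 with n ≟ t
  ... | yes refl = ≈-trans (+-congʳ (Σ<-zero n (λ j<n → g≈0 (m<n⇒m<1+n j<n) (<⇒≢ j<n)))) (+-identityˡ _)
  ... | no n≢t = ≈-trans
    (+-cong (Σ<-single n g (≤∧≢⇒< (≤-pred t<1+n) (n≢t ∘ sym)) (λ j<n → g≈0 (m<n⇒m<1+n j<n)))
            (g≈0 (n<1+n n) n≢t))
    (+-identityʳ _)

  module _ {a} {A : Set a} where

    []·-yes : (a? : Dec A) → A → ∀ x → [ a? ]· x ≈ x
    []·-yes (yes _) _ x = ≈-refl
    []·-yes (no ¬a) a x = ⊥-elim (¬a a)

    []·-no : (a? : Dec A) → ¬ A → ∀ x → [ a? ]· x ≈ 0#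
    []·-no (yes a) ¬a x = ⊥-elim (¬a a)
    []·-no (no _)  _  x = ≈-refl

    []·-cong : (a? : Dec A) {x y : Carrier} → (A → x ≈ y) → [ a? ]· x ≈ [ a? ]· y
    []·-cong (yes a) x≈y = x≈y a
    []·-cong (no _)  _   = ≈-refl

    []·-0# : (a? : Dec A) → [ a? ]· 0# ≈ 0#
    []·-0# (yes _) = ≈-refl
    []·-0# (no _)  = ≈-refl

    []·-neg : (a? : Dec A) → ∀ x → [ a? ]· (- x) ≈ - ([ a? ]· x)
    []·-neg (yes _) x = ≈-refl
    []·-neg (no _)  x = ≈-sym ε⁻¹≈ε

    []·-Σ< : (a? : Dec A) (n : ℕ) (g : ℕ → Carrier) → [ a? ]· (Σ< n g) ≈ Σ< n (λ j → [ a? ]· (g j))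
    []·-Σ< (yes _) n g = ≈-refl
    []·-Σ< (no _)  n g = ≈-sym (Σ<-zero n (λ _ → ≈-refl))

    []·-split : (a? : Dec A) → ∀ x → x ≈ [ a? ]· x ⊕ [ ¬? a? ]· x
    []·-split (yes _) x = ≈-sym (+-identityʳ x)
    []·-split (no _)  x = ≈-sym (+-identityˡ x)

    module _ {b} {B : Set b} where

      []·-⇔ : (a? : Dec A) (b? : Dec B) → (A → B) → (B → A) → ∀ x → [ a? ]· x ≈ [ b? ]· x
      []·-⇔ (yes _) (yes _) _  _  x = ≈-refl
      []·-⇔ (no _)  (no _)  _  _  x = ≈-refl
      []·-⇔ (yes a) (no ¬b) to _  x = ⊥-elim (¬b (to a))
      []·-⇔ (no ¬a) (yes b) _ from x = ⊥-elim (¬a (from b))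

      []·-comm : (a? : Dec A) (b? : Dec B) → ∀ x → [ a? ]· ([ b? ]· x) ≈ [ b? ]· ([ a? ]· x)
      []·-comm (yes _) (yes _) x = ≈-refl
      []·-comm (yes _) (no _)  x = ≈-refl
      []·-comm (no _)  (yes _) x = ≈-refl
      []·-comm (no _)  (no _)  x = ≈-refl

  ⊙-neg : ∀ z x → (ℤ.- z) ⊙ x ≈ - (z ⊙ x)
  ⊙-neg (ℤ.+ zero)  x = ≈-sym ε⁻¹≈ε
  ⊙-neg (ℤ.+ suc n) x = ≈-refl
  ⊙-neg -[1+ n ]   x = ≈-sym (⁻¹-involutive _)

  Σ<-multiples : ∀ b .{{_ : NonZero b}} q (h : ℕ → Carrier) →
                 Σ< (q * b) (λ j → [ b ∣? suc j ]· (h (suc j))) ≈ Σ< q (λ t → h (b * suc t))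
  Σ<-multiples b zero    h = ≈-refl
  Σ<-multiples b (suc q) h = begin
    Σ< (b + q * b) F                           ≡⟨ cong (λ m → Σ< m F) (+-comm b (q * b)) ⟩
    Σ< (q * b + b) F                           ≈⟨ Σ<-split (q * b) b F ⟩
    Σ< (q * b) F ⊕ Σ< b (λ u → F (q * b + u))  ≈⟨ +-cong (Σ<-multiples b q h) lastBlock ⟩
    Σ< q G ⊕ G q                               ∎
    where
    F G : ℕ → Carrier
    F j = [ b ∣? suc j ]· (h (suc j))
    G t = h (b * suc t)

    lastBlock : Σ< b (λ u → F (q * b + u)) ≈ G q
    lastBlock = begin
      Σ< b (λ u → F (q * b + u))
        ≈⟨ Σ<-single b _ (≤-reflexive (suc-pred b)) (λ u<b u≢pred-b →
             []·-no (b ∣? _) (λ b∣ → u≢pred-b (cong pred (multiple-in-block q u<b b∣))) _) ⟩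
      F (q * b + pred b)
        ≡⟨ cong (λ a → [ b ∣? a ]· (h a)) (1+[q*b+pred[b]]≡b*[1+q] q b) ⟩
      [ b ∣? b * suc q ]· (G q)
        ≈⟨ []·-yes (b ∣? b * suc q) (m∣m*n (suc q)) (G q) ⟩
      G q ∎

  Σ<-divisors-truncate : ∀ n .{{_ : NonZero n}} {a} (g : ℕ → Carrier) → n ≤ a →
                         Σ< a (λ i → [ suc i ∣? n ]· (g i)) ≈ Σ< n (λ i → [ suc i ∣? n ]· (g i))
  Σ<-divisors-truncate n g n≤a = Σ<-truncate _ n≤a (λ {i} n≤i →
    []·-no (suc i ∣? n) (λ i+1∣n → <⇒≱ (s≤s n≤i) (∣⇒≤ i+1∣n)) (g i))

  Σ<-μ-divisors[p*M]≈0 : ∀ {p} M .{{_ : NonZero M}} → Prime p → ∀ x →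
                         Σ< (p * M) (λ j → [ suc j ∣? p * M ]· (μ (suc j) ⊙ x)) ≈ 0#
  Σ<-μ-divisors[p*M]≈0 {p} M p-prime x = begin
    Σ< (p * M) (λ j → h (suc j))
      ≈⟨ Σ<-cong (p * M) (λ j → []·-split (p ∣? suc j) (h (suc j))) ⟩
    Σ< (p * M) (λ j → [ p ∣? suc j ]· (h (suc j)) ⊕ [ ¬? (p ∣? suc j) ]· (h (suc j)))
      ≈⟨ Σ<-distrib-⊕ (p * M) _ _ ⟩
    Σ< (p * M) (λ j → [ p ∣? suc j ]· (h (suc j))) ⊕ Σ< (p * M) (λ j → [ ¬? (p ∣? suc j) ]· (h (suc j)))
      ≈⟨ +-cong multiples nonMultiples ⟩
    - Σ< M B ⊕ Σ< M B
      ≈⟨ -‿inverseˡ (Σ< M B) ⟩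
    0# ∎
    where
    instance
      p≢0 : NonZero p
      p≢0 = prime⇒nonZero p-prime

    h : ℕ → Carrier
    h a = [ a ∣? p * M ]· (μ a ⊙ x)

    B : ℕ → Carrier
    B t = [ suc t ∣? M ]· ([ ¬? (p ∣? suc t) ]· (μ (suc t) ⊙ x))

    h[p*a]≈-B : ∀ t → h (p * suc t) ≈ - B t
    h[p*a]≈-B t with p ∣? suc t
    ... | yes p∣ = begin
      [ p * suc t ∣? p * M ]· (μ (p * suc t) ⊙ x)
        ≡⟨ cong (λ z → [ p * suc t ∣? p * M ]· (z ⊙ x)) (μ[p*k]≡0 p-prime p∣) ⟩
      [ p * suc t ∣? p * M ]· 0#                   ≈⟨ []·-0# (p * suc t ∣? p * M) ⟩
      0#                                          ≈⟨ ε⁻¹≈ε ⟨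
      - 0#                                        ≈⟨ -‿cong ([]·-0# (suc t ∣? M)) ⟨
      - ([ suc t ∣? M ]· 0#)                       ∎
    ... | no p∤ = begin
      [ p * suc t ∣? p * M ]· (μ (p * suc t) ⊙ x)
        ≡⟨ cong (λ z → [ p * suc t ∣? p * M ]· (z ⊙ x)) (μ[p*k]≡-μ[k] p-prime p∤) ⟩
      [ p * suc t ∣? p * M ]· ((ℤ.- μ (suc t)) ⊙ x)
        ≈⟨ []·-⇔ (p * suc t ∣? p * M) (suc t ∣? M) (*-cancelˡ-∣ p) (*-monoʳ-∣ p) _ ⟩
      [ suc t ∣? M ]· ((ℤ.- μ (suc t)) ⊙ x)
        ≈⟨ []·-cong (suc t ∣? M) (λ _ → ⊙-neg (μ (suc t)) x) ⟩
      [ suc t ∣? M ]· (- (μ (suc t) ⊙ x))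
        ≈⟨ []·-neg (suc t ∣? M) _ ⟩
      - ([ suc t ∣? M ]· (μ (suc t) ⊙ x))
        ∎

    multiples : Σ< (p * M) (λ j → [ p ∣? suc j ]· (h (suc j))) ≈ - Σ< M B
    multiples = begin
      Σ< (p * M) (λ j → [ p ∣? suc j ]· (h (suc j)))
        ≡⟨ cong (λ n → Σ< n (λ j → [ p ∣? suc j ]· (h (suc j)))) (*-comm p M) ⟩
      Σ< (M * p) (λ j → [ p ∣? suc j ]· (h (suc j)))
        ≈⟨ Σ<-multiples p M h ⟩
      Σ< M (λ t → h (p * suc t))
        ≈⟨ Σ<-cong M h[p*a]≈-B ⟩
      Σ< M (λ t → - B t)
        ≈⟨ Σ<-distrib-neg M B ⟩
      - Σ< M B
        ∎

    nonMultiples : Σ< (p * M) (λ j → [ ¬? (p ∣? suc j) ]· (h (suc j))) ≈ Σ< M B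
    nonMultiples = begin
      Σ< (p * M) (λ j → [ ¬? (p ∣? suc j) ]· (h (suc j)))
        ≈⟨ Σ<-cong (p * M) (λ j → ≈-trans ([]·-cong (¬? (p ∣? suc j)) (λ p∤ →
             []·-⇔ (suc j ∣? p * M) (suc j ∣? M)
                   (coprime-divisor (prime∤⇒coprime p-prime p∤)) (∣n⇒∣m*n p) _))
             ([]·-comm (¬? (p ∣? suc j)) (suc j ∣? M) _)) ⟩
      Σ< (p * M) B              ≈⟨ Σ<-divisors-truncate M _ (m≤n*m M p) ⟩
      Σ< M B                    ∎

  Σ<-μ-divisors : ∀ N .{{_ : NonZero N}} x → Σ< N (λ j → [ suc j ∣? N ]· (μ (suc j) ⊙ x)) ≈ [ N ≟ 1 ]· x
  Σ<-μ-divisors N x with N ≟ 1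
  ... | yes refl = ≈-trans (+-identityˡ _) (+-identityʳ x)
  ... | no N≢1 with prime-factor N N≢1
  ...   | p , M , p-prime , refl = Σ<-μ-divisors[p*M]≈0 M {{m*n≢0⇒n≢0 p}} p-prime x

  Σ<-μ-multiples : ∀ m e .{{_ : NonZero m}} .{{_ : NonZero e}} x →
                   Σ< m (λ i → [ suc i * e ∣? m ]· (μ (suc i) ⊙ x)) ≈ [ e ≟ m ]· x
  Σ<-μ-multiples m e x with e ∣? m
  ... | no e∤m = ≈-trans
    (Σ<-zero m (λ {i} _ → []·-no (suc i * e ∣? m) (λ ie∣m → e∤m (m*n∣⇒n∣ (suc i) e ie∣m)) _))
    (≈-sym ([]·-no (e ≟ m) (λ { refl → e∤m ∣-refl }) x))
  ... | yes e∣m = begin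
    Σ< m (λ i → [ suc i * e ∣? m ]· (μ (suc i) ⊙ x))
      ≈⟨ Σ<-cong m (λ i → []·-⇔ (suc i * e ∣? m) (suc i ∣? m / e)
                                (m*n∣o⇒m∣o/n (suc i) e) (m∣n/o⇒m*o∣n e∣m) _) ⟩
    Σ< m (λ i → [ suc i ∣? m / e ]· (μ (suc i) ⊙ x))
      ≈⟨ Σ<-divisors-truncate (m / e) _ (m/n≤m m e) ⟩
    Σ< (m / e) (λ i → [ suc i ∣? m / e ]· (μ (suc i) ⊙ x))
      ≈⟨ Σ<-μ-divisors (m / e) x ⟩
    [ m / e ≟ 1 ]· x
      ≈⟨ []·-⇔ (m / e ≟ 1) (e ≟ m) (m/n≡1⇒n≡m e∣m) (λ { refl → n/n≡1 m }) x ⟩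
    [ e ≟ m ]· x ∎
    where
    instance
      m/e≢0 : NonZero (m / e)
      m/e≢0 = >-nonZero (m≥n⇒m/n>0 (∣⇒≤ e∣m))

  Σ<-divisors-multiples : ∀ m k .{{_ : NonZero m}} .{{_ : NonZero k}} (y : ℕ → Carrier) →
    Σ< m (λ j → [ suc j ∣? m ]· ([ k ∣? suc j ]· (y (suc j)))) ≈
    Σ< m (λ t → [ k * suc t ∣? m ]· (y (k * suc t)))
  Σ<-divisors-multiples m k y = begin
    Σ< m (λ j → [ suc j ∣? m ]· ([ k ∣? suc j ]· (y (suc j))))
      ≈⟨ Σ<-divisors-truncate m _ (m≤m*n m k) ⟨
    Σ< (m * k) (λ j → [ suc j ∣? m ]· ([ k ∣? suc j ]· (y (suc j))))
      ≈⟨ Σ<-cong (m * k) (λ j → []·-comm (suc j ∣? m) (k ∣? suc j) _) ⟩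
    Σ< (m * k) (λ j → [ k ∣? suc j ]· ([ suc j ∣? m ]· (y (suc j))))
      ≈⟨ Σ<-multiples k m (λ a → [ a ∣? m ]· (y a)) ⟩
    Σ< m (λ t → [ k * suc t ∣? m ]· (y (k * suc t)))
      ∎

  Σ<-last : ∀ m .{{_ : NonZero m}} (g : ℕ → Carrier) → Σ< m (λ t → [ suc t ≟ m ]· (g (suc t))) ≈ g m
  Σ<-last m g = begin
    Σ< m (λ t → [ suc t ≟ m ]· (g (suc t)))
      ≈⟨ Σ<-single m _ (≤-reflexive (suc-pred m)) (λ _ t≢pred-m →
           []·-no (suc _ ≟ m) (λ 1+t≡m → t≢pred-m (cong pred 1+t≡m)) _) ⟩
    [ suc (pred m) ≟ m ]· (g (suc (pred m)))
      ≡⟨ cong (λ a → [ a ≟ m ]· (g a)) (suc-pred m) ⟩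
    [ m ≟ m ]· (g m)
      ≈⟨ []·-yes (m ≟ m) refl (g m) ⟩
    g m ∎

  möbius-inversion : ∀ (f : ℕ → Carrier) m .{{_ : NonZero m}} →
                     Σ< m (λ j → [ suc j ∣? m ]· ((μ* f) (suc j))) ≈ f m
  möbius-inversion f m = begin
    Σ< m (λ j → [ suc j ∣? m ]· ((μ* f) (suc j)))
      ≈⟨ Σ<-cong m (λ j → expand j) ⟩
    Σ< m (λ j → Σ< m (λ i → K i j))
      ≈⟨ Σ<-comm m m K ⟨
    Σ< m (λ i → Σ< m (λ j → K i j))
      ≈⟨ Σ<-cong m (λ i → Σ<-divisors-multiples m (suc i) (λ a → μ (suc i) ⊙ f (a / suc i))) ⟩
    Σ< m (λ i → Σ< m (λ t → [ suc i * suc t ∣? m ]· (μ (suc i) ⊙ f (suc i * suc t / suc i))))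
      ≈⟨ Σ<-cong m (λ i → Σ<-cong m (λ t →
           reflexive (cong (λ a → [ suc i * suc t ∣? m ]· (μ (suc i) ⊙ f a)) (m*n/m≡n (suc i) (suc t))))) ⟩
    Σ< m (λ i → Σ< m (λ t → [ suc i * suc t ∣? m ]· (μ (suc i) ⊙ f (suc t))))
      ≈⟨ Σ<-comm m m _ ⟩
    Σ< m (λ t → Σ< m (λ i → [ suc i * suc t ∣? m ]· (μ (suc i) ⊙ f (suc t))))
      ≈⟨ Σ<-cong m (λ t → Σ<-μ-multiples m (suc t) (f (suc t))) ⟩
    Σ< m (λ t → [ suc t ≟ m ]· (f (suc t)))
      ≈⟨ Σ<-last m f ⟩
    f m ∎
    where
    K : ℕ → ℕ → Carrier
    K i j = [ suc j ∣? m ]· ([ suc i ∣? suc j ]· (μ (suc i) ⊙ f (suc j / suc i)))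

    expand : ∀ j → [ suc j ∣? m ]· ((μ* f) (suc j)) ≈ Σ< m (λ i → K i j)
    expand j = ≈-trans
      ([]·-cong (suc j ∣? m) (λ j+1∣m → ≈-sym (Σ<-divisors-truncate (suc j) _ (∣⇒≤ j+1∣m))))
      ([]·-Σ< (suc j ∣? m) m _)

  Σ<-inverse-residues : ∀ {E d} .{{_ : NonZero E}} .{{_ : NonZero d}} → Coprime E d → ∀ Q y →
                        Σ< (Q * E) (λ t → [ E ∣? pred (d * suc t) ]· y) ≈ Q ·ℕ y
  Σ<-inverse-residues E⊥d zero    y = ≈-refl
  Σ<-inverse-residues {E} {d} E⊥d (suc Q) y = begin
    Σ< (E + Q * E) H                        ≈⟨ Σ<-split E (Q * E) H ⟩
    Σ< E H ⊕ Σ< (Q * E) (λ t → H (E + t))   ≈⟨ +-cong oneSolution (Σ<-cong (Q * E) (λ t → periodic t)) ⟩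
    y ⊕ Σ< (Q * E) H                        ≈⟨ +-congˡ (Σ<-inverse-residues E⊥d Q y) ⟩
    y ⊕ Q ·ℕ y                              ∎
    where
    H : ℕ → Carrier
    H t = [ E ∣? pred (d * suc t) ]· y

    periodic : ∀ t → H (E + t) ≈ H t
    periodic t = []·-⇔ (E ∣? _) (E ∣? _) (to ∘ subst (λ a → E ∣ pred (d * suc a)) (+-comm E t))
                                         (subst (λ a → E ∣ pred (d * suc a)) (+-comm t E) ∘ from) y
      where open Equivalence (∣pred[d*suc[t+k]]⇔ t (n∣m*n d))

    oneSolution : Σ< E H ≈ y
    oneSolution with inverse-residue E⊥d
    ... | t₀ , t₀<E , E∣t₀ = ≈-trans
      (Σ<-single E H t₀<E (λ t<E t≢t₀ →
         []·-no (E ∣? _) (λ E∣t → t≢t₀ (inverse-residue-unique E⊥d t<E t₀<E E∣t E∣t₀)) y))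
      ([]·-yes (E ∣? _) E∣t₀ y)

  Σ<-[d∣1+j]·[e∣gcd[j,n]] : ∀ n d e .{{_ : NonZero d}} .{{_ : NonZero e}} → d ∣ n → ∀ y →
    Σ< n (λ j → [ d ∣? suc j ]· ([ e ∣? gcd j n ]· y)) ≈
    [ (e ∣? n) ×-dec (gcd e d ≟ 1) ]· ((n / d / e) ·ℕ y)
  Σ<-[d∣1+j]·[e∣gcd[j,n]] n d e d∣n y with (e ∣? n) ×-dec (gcd e d ≟ 1)
  ... | no ¬[e∣n×e⊥d] = Σ<-zero n (λ {j} _ → ≈-trans
    ([]·-cong (d ∣? suc j) (λ d∣1+j →
      []·-no (e ∣? gcd j n) (λ e∣gcd → ¬[e∣n×e⊥d] (∣1+j∧∣gcd[j,n]⇒∣n×gcd≡1 d∣1+j e∣gcd)) y))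
    ([]·-0# (d ∣? suc j)))
  ... | yes (e∣n , gcd[e,d]≡1) = begin
    Σ< n (λ j → [ d ∣? suc j ]· ([ e ∣? gcd j n ]· y))
      ≈⟨ Σ<-cong n (λ j → []·-cong (d ∣? suc j) (λ _ →
           []·-⇔ (e ∣? gcd j n) (e ∣? j) (λ e∣gcd → ∣-trans e∣gcd (gcd[m,n]∣m j n))
                                         (λ e∣j → gcd-greatest e∣j e∣n) y)) ⟩
    Σ< n (λ j → [ d ∣? suc j ]· ([ e ∣? pred (suc j) ]· y))
      ≡⟨ cong (λ m → Σ< m (λ j → [ d ∣? suc j ]· ([ e ∣? pred (suc j) ]· y))) (m/n*n≡m d∣n) ⟨
    Σ< (n / d * d) (λ j → [ d ∣? suc j ]· ([ e ∣? pred (suc j) ]· y))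
      ≈⟨ Σ<-multiples d (n / d) (λ a → [ e ∣? pred a ]· y) ⟩
    Σ< (n / d) (λ t → [ e ∣? pred (d * suc t) ]· y)
      ≡⟨ cong (λ m → Σ< m (λ t → [ e ∣? pred (d * suc t) ]· y)) (m/n*n≡m e∣n/d) ⟨
    Σ< (n / d / e * e) (λ t → [ e ∣? pred (d * suc t) ]· y)
      ≈⟨ Σ<-inverse-residues e⊥d (n / d / e) y ⟩
    (n / d / e) ·ℕ y ∎
    where
    e⊥d : Coprime e d
    e⊥d = gcd≡1⇒coprime gcd[e,d]≡1
    e∣n/d : e ∣ n / d
    e∣n/d = coprime-divisor e⊥d (subst (e ∣_) (sym (m*[n/m]≡n d∣n)) e∣n)

lemma2 : {c ℓ : Level} (R : CommutativeRing c ℓ) →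
  let open CommutativeRing R
      open Arith R
      open RM (+-rawMonoid) using () renaming (_×_ to _·ℕ_)
  in (f : ℕ → Carrier) (n d : ℕ) → .{{_ : NonZero n}} → .{{_ : NonZero d}} → d ∣ n →
     Σ< n (λ j → [ d ∣? suc j ]· (f (gcd j n)))
     ≈ Σ< n (λ j → [ (suc j ∣? n) ×-dec (gcd (suc j) d ≟ℕ 1) ]· (((n / d) / suc j) ·ℕ (μ* f) (suc j)))
lemma2 R f n d d∣n = begin
  Σ< n (λ j → [ d ∣? suc j ]· (f (gcd j n)))
    ≈⟨ Σ<-cong n (λ j → []·-cong (d ∣? suc j) (λ _ → divisor-expansion j)) ⟩
  Σ< n (λ j → [ d ∣? suc j ]· (Σ< n (λ e → [ suc e ∣? gcd j n ]· ((μ* f) (suc e)))))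
    ≈⟨ Σ<-cong n (λ j → []·-Σ< (d ∣? suc j) n _) ⟩
  Σ< n (λ j → Σ< n (λ e → [ d ∣? suc j ]· ([ suc e ∣? gcd j n ]· ((μ* f) (suc e)))))
    ≈⟨ Σ<-comm n n _ ⟩
  Σ< n (λ e → Σ< n (λ j → [ d ∣? suc j ]· ([ suc e ∣? gcd j n ]· ((μ* f) (suc e)))))
    ≈⟨ Σ<-cong n (λ e → Σ<-[d∣1+j]·[e∣gcd[j,n]] n d (suc e) d∣n ((μ* f) (suc e))) ⟩
  Σ< n (λ e → [ (suc e ∣? n) ×-dec (gcd (suc e) d ≟ 1) ]· (((n / d) / suc e) ·ℕ (μ* f) (suc e))) ∎
  where
  open CommutativeRing R using (_≈_; setoid) renaming (sym to ≈-sym; trans to ≈-trans)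
  open Arith R
  open RM (CommutativeRing.+-rawMonoid R) using () renaming (_×_ to _·ℕ_)
  open Sums R
  open SetoidReasoning setoid

  divisor-expansion : ∀ j → f (gcd j n) ≈ Σ< n (λ e → [ suc e ∣? gcd j n ]· ((μ* f) (suc e)))
  divisor-expansion j = ≈-sym (≈-trans
    (Σ<-divisors-truncate (gcd j n) _ (∣⇒≤ (gcd[m,n]∣n j n)))
    (möbius-inversion f (gcd j n)))
    where
    instance
      gcd≢0 : NonZero (gcd j n)
      gcd≢0 = ≢-nonZero (gcd[m,n]≢0 j n (inj₂ (≢-nonZero⁻¹ n)))
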